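{- Let $\vec c=(c_1,\dots,c_k)$ be a composition of $n$ with $c_k>0$ and let $\alpha\in\mathfrak S_n$. Then the chain $g_\alpha=\sum_{\gamma\in\mathfrak S^c_{\vec c}}(-1)^{\gamma}\,\sigma(\alpha\circ\gamma,\vec c)$ in $C_{k-2}(\Delta_{\vec c})$ lies in the kernel of the boundary map, and hence defines an element of the homology group $\widetilde H_{k-2}(\Delta_{\vec c})$.
   Context: A pointed composition of $n$ is $(c_1,\dots,c_k)$ with $c_1,\dots,c_{k-1}\ge1$, $c_k\ge0$, sum $n$, ordered by $\vec c\le\vec d$ iff $\vec d$ is obtained from $\vec c$ by replacing runs of consecutive entries by their sums. An ordered set partition of $[n]$ is $(C_1,\dots,C_r)$, pairwise disjoint with union $[n]$, $C_1,\dots,C_{r-1}$ nonempty, $C_r$ possibly empty; type $(|C_1|,\dots,|C_r|)$. $\Delta_n$ is the simplicial complex with these faces ($(C_1,\dots,C_r)$ of dimension $r-2$, faces obtained by merging consecutive blocks, $([n])$ the empty face), and $\Delta_{\vec c}=\{\tau\in\Delta_n:\vec c\le\operatorname{type}(\tau)\}$. The chain group $C_j(\Delta_{\vec c})$ is free on the faces of dimension $j$, with boundary $\partial(C_1,\dots,C_r)=\sum_{i=1}^{r-1}(-1)^{i-1}(C_1,\dots,C_i\cup C_{i+1},\dots,C_r)$; $\widetilde H$ is reduced homology. For $\alpha=\alpha_1\cdots\alpha_n$, $\sigma(\alpha,\vec c)=(\{\alpha_j:j\in R_1\},\dots,\{\alpha_j:j\in R_k\})$ with $R_i=[c_1+\dots+c_{i-1}+1,c_1+\dots+c_i]$;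 $\alpha\circ\gamma$ is $j\mapsto\alpha_{\gamma(j)}$; $(-1)^\gamma$ is the sign of $\gamma$. The column intervals $K_1,\dots,K_{n-k+1}$ of $\vec c$ are the maximal intervals of $[n]$ such that $j$ and $j+1$ lie in the same interval iff $j\in\{c_1,c_1+c_2,\dots,c_1+\dots+c_{k-1}\}$; $\mathfrak S^c_{\vec c}=\mathfrak S_{K_1}\times\cdots\times\mathfrak S_{K_{n-k+1}}$. -}

module Defs where

open import Data.Nat as ℕ using (ℕ; zero; suc; _≤ᵇ_; _<ᵇ_; _≡ᵇ_)
open import Data.Integer as ℤ using (ℤ; +_; -_)
open import Data.Bool using (Bool; true; false; if_then_else_; _∧_; not)
import Data.Bool as B
open import Data.Fin using (Fin; toℕ)
import Data.Fin as F
open import Data.Fin.Subset using (Subset; ⁅_⁆; _∪_; ⊥)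
open import Data.Fin.Permutation using (Permutation′; _⟨$⟩ʳ_)
open import Data.Vec using (Vec; []; _∷_; lookup)
import Data.Vec.Properties as VP
open import Data.List using (List; []; _∷_; map; filter; concatMap; take; drop;
  foldr; allFin; zipWith; upTo; length; applyUpTo; _++_)
open import Data.Bool.ListAction using (all; any)
import Data.Nat.ListAction as NL
import Data.List.Properties as LP
open import Data.Product using (_×_; _,_)
open import Relation.Nullary using (does)
open import Relation.Binary.PropositionalEquality using (_≡_)

-- Permutations of [n] (used as the summation range).
-- A map γ : [n] → [n] is stored as the word (γ(1),…,γ(n)) : Vec (Fin n) n.

allWords : (n m : ℕ) → List (Vec (Fin n) m)
allWords n zero    = [] ∷ []
allWords n (suc m) = concatMap (λ x → map (x ∷_) (allWords n m)) (allFin n)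

injectiveᵇ : ∀ {n} → Vec (Fin n) n → Bool
injectiveᵇ {n} γ =
  all (λ i → all (λ j → (toℕ i ≡ᵇ toℕ j) B.∨ not (toℕ (lookup γ i) ≡ᵇ toℕ (lookup γ j)))
                 (allFin n))
      (allFin n)

-- the symmetric group 𝔖_n, enumerated (each element exactly once)
Sym : (n : ℕ) → List (Vec (Fin n) n)
Sym n = filter (λ γ → B.T? (injectiveᵇ γ)) (allWords n n)

inversions : ∀ {n} → Vec (Fin n) n → ℕ
inversions {n} γ =
  NL.sum (map (λ i → Data.List.length
     (filter (λ j → B.T? ((toℕ i <ᵇ toℕ j) ∧ (toℕ (lookup γ j) <ᵇ toℕ (lookup γ i))))
             (allFin n))) (allFin n))

sign : ∀ {n} → Vec (Fin n) n → ℤ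
sign γ = (- (+ 1)) ℤ.^ inversions γ

-- Compositions and column intervals (positions are 1-indexed)

-- partial sums c₁, c₁+c₂, …, c₁+⋯+c_{k-1}
cuts : List ℕ → List ℕ
cuts []             = []
cuts (x ∷ [])       = []
cuts (x ∷ y ∷ rest) = x ∷ map (x ℕ.+_) (cuts (y ∷ rest))

isCut : List ℕ → ℕ → Bool
isCut c m = any (m ≡ᵇ_) (cuts c)

-- a < b lie in the same column interval iff a, a+1, …, b-1 are all cuts
sameColumn : List ℕ → ℕ → ℕ → Bool
sameColumn c a b with a ≤ᵇ b
... | true  = all (isCut c) (applyUpTo (a ℕ.+_) (b ℕ.∸ a))
... | false = all (isCut c) (applyUpTo (b ℕ.+_) (a ℕ.∸ b))

-- γ ∈ 𝔖^c_c  iff  γ maps every position into its own column interval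
-- (equivalently γ preserves every column interval K_j, as [n] is finite)
inColumnGroup : ∀ {n} → List ℕ → Vec (Fin n) n → Bool
inColumnGroup {n} c γ =
  all (λ j → sameColumn c (suc (toℕ j)) (suc (toℕ (lookup γ j)))) (allFin n)

-- Ordered set partitions (C₁,…,C_r) as lists of subsets of [n]

Face : ℕ → Set
Face n = List (Subset n)

_≟Face_ : ∀ {n} (x y : Face n) → Relation.Nullary.Dec (x ≡ y)
_≟Face_ = LP.≡-dec (VP.≡-dec B._≟_)

letters : ∀ {n} → List (Fin n) → Subset n
letters = foldr (λ x s → ⁅ x ⁆ ∪ s) ⊥

σ : ∀ {n} → List (Fin n) → List ℕ → Face n
σ w []       = []
σ w (c ∷ cs) = letters (take c w) ∷ σ (drop c w) cs

compose : ∀ {n} → Permutation′ n → Vec (Fin n) n → List (Fin n)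
compose {n} α γ = map (λ j → α ⟨$⟩ʳ lookup γ j) (allFin n)

-- Chains: finite formal ℤ-linear combinations of faces

Chain : ℕ → Set
Chain n = List (ℤ × Face n)

coeff : ∀ {n} → Face n → Chain n → ℤ
coeff ρ []             = + 0
coeff ρ ((z , τ) ∷ ch) with does (τ ≟Face ρ)
... | true  = z ℤ.+ coeff ρ ch
... | false = coeff ρ ch

merges : ∀ {n} → Face n → List (Face n)
merges (a ∷ b ∷ rest) = ((a ∪ b) ∷ rest) ∷ map (a ∷_) (merges (b ∷ rest))
merges _              = []

∂face : ∀ {n} → Face n → Chain n
∂face τ = zipWith (λ i τ' → ((- (+ 1)) ℤ.^ i , τ')) (upTo (length (merges τ))) (merges τ)

∂ : ∀ {n} → Chain n → Chain n
∂ = concatMap (λ { (z , τ) → map (λ { (s , τ') → (z ℤ.* s , τ') }) (∂face τ) })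

IsZero : ∀ {n} → Chain n → Set
IsZero ch = ∀ ρ → coeff ρ ch ≡ + 0

g : ∀ {n} → List ℕ → Permutation′ n → Chain n
g {n} c α = map (λ γ → (sign γ , σ (compose α γ) c))
                (filter (λ γ → B.T? (inColumnGroup c γ)) (Sym n))

module Submission where

-- Every face σ(α∘γ, c) has k blocks, so the coefficient of a
-- face ρ in ∂ g_α is Σ_{i < k-1} (-1)^i Σ_{γ ∈ 𝔖^c_c} (-1)^γ [merge_i σ(α∘γ, c) = ρ],
-- where merge_i merges blocks i and i+1.  Fix i and let s+1 = c₁ + ⋯ + c_{i+1} be the
-- (i+1)-th cut; since all parts are positive, 0 < s+1 < n.  Precomposition with the
-- transposition τ of positions s and s+1 (0-indexed)
--   * preserves 𝔖^c_c, because s+1 is a cut, so both positions lie in one column interval;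
--   * does not change merge_i σ(α∘γ, c), which only sees the set of letters of the merged block;
--   * reverses the sign (-1)^γ, since it changes the inversion count by exactly one.
-- So the inner sum, taken over all words γ, is antisymmetric under an involution of the set
-- of words and vanishes.

open import Defs
open import Data.Nat as ℕ using (ℕ; zero; suc; _+_; _∸_; _<_; _≤_; _>_; s≤s; z≤n; _≡ᵇ_; _<ᵇ_; _≤ᵇ_)
import Data.Nat.Properties as ℕP
open import Data.Nat.ListAction using (sum)
open import Data.Integer as ℤ using (ℤ; +_; -_; -[1+_])
import Data.Integer.Properties as ℤP
open import Data.Bool using (Bool; true; false; if_then_else_; _∧_; _∨_; not; T)
import Data.Bool as B
import Data.Bool.Properties as BP
open import Data.Bool.ListAction using (all; any)
open import Data.Fin using (Fin; toℕ; fromℕ<) renaming (zero to fz; suc to fs)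
import Data.Fin.Properties as FP
open import Data.Fin.Subset using (Subset; ⁅_⁆; _∪_)
import Data.Fin.Subset.Properties as SP
open import Data.Fin.Permutation using (Permutation′; _⟨$⟩ʳ_)
open import Data.Vec using (Vec; []; _∷_; lookup)
open import Data.List using (List; []; _∷_; map; filter; concatMap; foldr; allFin; tabulate;
  take; drop; zipWith; applyUpTo; length; _++_)
import Data.List.Properties as LP
open import Data.List.Relation.Unary.All using (All; _∷_)
import Data.List.Relation.Unary.All as All
open import Data.List.Relation.Unary.All.Properties using (all⁺)
open import Data.List.Membership.Propositional.Properties using (∈-allFin)
open import Data.Product using (_,_; proj₁; proj₂)
open import Data.Empty using (⊥-elim)
open import Function using (_∘_; id; mk⇔; Equivalence)
open import Relation.Nullary using (does; ¬_)
open import Relation.Nullary.Decidable using (dec-true; dec-false; does-⇔)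
open import Relation.Binary.PropositionalEquality
open import Relation.Binary.Definitions using (tri<; tri≈; tri>)
open import Algebra.Properties.CommutativeSemigroup ℤP.+-commutativeSemigroup
  using () renaming (interchange to ℤ-interchange)
open import Algebra.Properties.CommutativeSemigroup ℕP.+-commutativeSemigroup
  using () renaming (interchange to ℕ-interchange)

-- The adjacent transposition s ↔ s+1 (0-indexed), acting on lists, on
-- vectors and on indices; it is the identity when position s+1 does not exist.
swap : ∀ {A : Set} → ℕ → List A → List A
swap zero    (x ∷ y ∷ l) = y ∷ x ∷ l
swap zero    l           = l
swap (suc s) []          = []
swap (suc s) (x ∷ l)     = x ∷ swap s l

swapᵛ : ∀ {A : Set} {m} → ℕ → Vec A m → Vec A m
swapᵛ zero    (x ∷ y ∷ l) = y ∷ x ∷ l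
swapᵛ zero    l           = l
swapᵛ (suc s) []          = []
swapᵛ (suc s) (x ∷ l)     = x ∷ swapᵛ s l

τ : ∀ {m} → ℕ → Fin m → Fin m
τ {suc (suc m)} zero fz           = fs fz
τ {suc (suc m)} zero (fs fz)      = fz
τ {suc (suc m)} zero (fs (fs j))  = fs (fs j)
τ {suc zero}    zero j            = j
τ               (suc s) fz        = fz
τ               (suc s) (fs j)    = fs (τ s j)

τ-involutive : ∀ {m} s (j : Fin m) → τ s (τ s j) ≡ j
τ-involutive {suc (suc m)} zero fz          = refl
τ-involutive {suc (suc m)} zero (fs fz)     = refl
τ-involutive {suc (suc m)} zero (fs (fs j)) = refl
τ-involutive {suc zero}    zero j           = refl
τ-involutive               (suc s) fz       = refl
τ-involutive               (suc s) (fs j)   = cong fs (τ-involutive s j)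

lookup-swapᵛ : ∀ {A : Set} {m} s (w : Vec A m) (j : Fin m) → lookup (swapᵛ s w) j ≡ lookup w (τ s j)
lookup-swapᵛ zero    (x ∷ y ∷ w) fz          = refl
lookup-swapᵛ zero    (x ∷ y ∷ w) (fs fz)     = refl
lookup-swapᵛ zero    (x ∷ y ∷ w) (fs (fs j)) = refl
lookup-swapᵛ zero    (x ∷ [])    fz          = refl
lookup-swapᵛ (suc s) (x ∷ w)     fz          = refl
lookup-swapᵛ (suc s) (x ∷ w)     (fs j)      = lookup-swapᵛ s w j

tabulate-∘τ : ∀ {A : Set} {m} s (h : Fin m → A) → tabulate (h ∘ τ s) ≡ swap s (tabulate h)
tabulate-∘τ {m = zero}        zero    h = refl
tabulate-∘τ {m = suc zero}    zero    h = refl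
tabulate-∘τ {m = suc (suc m)} zero    h = refl
tabulate-∘τ {m = zero}        (suc s) h = refl
tabulate-∘τ {m = suc m}       (suc s) h = cong (h fz ∷_) (tabulate-∘τ s (h ∘ fs))

compose-swap : ∀ {n} (α : Permutation′ n) s (w : Vec (Fin n) n) →
  compose α (swapᵛ s w) ≡ swap s (compose α w)
compose-swap {n} α s w = begin
  map (λ j → α ⟨$⟩ʳ lookup (swapᵛ s w) j) (allFin n)
    ≡⟨ LP.map-cong (λ j → cong (α ⟨$⟩ʳ_) (lookup-swapᵛ s w j)) (allFin n) ⟩
  map (λ j → α ⟨$⟩ʳ lookup w (τ s j)) (allFin n)
    ≡⟨ LP.map-tabulate id _ ⟩
  tabulate (λ j → α ⟨$⟩ʳ lookup w (τ s j))
    ≡⟨ tabulate-∘τ s _ ⟩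
  swap s (tabulate (λ j → α ⟨$⟩ʳ lookup w j))
    ≡⟨ cong (swap s) (LP.map-tabulate id _) ⟨
  swap s (compose α w) ∎
  where open ≡-Reasoning

-- A right fold by a left-commutative operation ignores the order of the
-- list, so folds over all indices can be reindexed by τ s.
LeftCommutative : ∀ {A B : Set} → (A → B → B) → Set
LeftCommutative op = ∀ a b r → op a (op b r) ≡ op b (op a r)

foldr-swap : ∀ {A B : Set} {op : A → B → B} → LeftCommutative op →
  ∀ e s l → foldr op e (swap s l) ≡ foldr op e l
foldr-swap lc e zero    []          = refl
foldr-swap lc e zero    (x ∷ [])    = refl
foldr-swap lc e zero    (x ∷ y ∷ l) = lc y x _
foldr-swap lc e (suc s) []          = refl
foldr-swap {op = op} lc e (suc s) (x ∷ l) = cong (op x) (foldr-swap lc e s l)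

foldr-reindex : ∀ {A B : Set} {op : A → B → B} → LeftCommutative op →
  ∀ e {m} s (p : Fin m → A) → foldr op e (map (p ∘ τ s) (allFin m)) ≡ foldr op e (map p (allFin m))
foldr-reindex {op = op} lc e {m} s p = begin
  foldr op e (map (p ∘ τ s) (allFin m))  ≡⟨ cong (foldr op e) (LP.map-tabulate id (p ∘ τ s)) ⟩
  foldr op e (tabulate (p ∘ τ s))        ≡⟨ cong (foldr op e) (tabulate-∘τ s p) ⟩
  foldr op e (swap s (tabulate p))       ≡⟨ foldr-swap lc e s _ ⟩
  foldr op e (tabulate p)                ≡⟨ cong (foldr op e) (LP.map-tabulate id p) ⟨
  foldr op e (map p (allFin m))          ∎
  where open ≡-Reasoning

all-reindex : ∀ {m} s (p : Fin m → Bool) → all (p ∘ τ s) (allFin m) ≡ all p (allFin m)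
all-reindex = foldr-reindex ∧-lc true
  where
  ∧-lc : LeftCommutative _∧_
  ∧-lc a b r = trans (sym (BP.∧-assoc a b r)) (trans (cong (_∧ r) (BP.∧-comm a b)) (BP.∧-assoc b a r))

sum-reindex : ∀ {m} s (p : Fin m → ℕ) → sum (map (p ∘ τ s) (allFin m)) ≡ sum (map p (allFin m))
sum-reindex = foldr-reindex +-lc 0
  where
  +-lc : LeftCommutative _+_
  +-lc a b r = trans (sym (ℕP.+-assoc a b r)) (trans (cong (_+ r) (ℕP.+-comm a b)) (ℕP.+-assoc b a r))

data τ-Action (s : ℕ) : ℕ → ℕ → Set where
  moves-up   : τ-Action s s (suc s)
  moves-down : τ-Action s (suc s) s
  fixed      : ∀ {x} → x ≢ s → x ≢ suc s → τ-Action s x x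

τ-action : ∀ {m} s (i : Fin m) → suc s < m → τ-Action s (toℕ i) (toℕ (τ s i))
τ-action {suc (suc m)} zero fz          _ = moves-up
τ-action {suc (suc m)} zero (fs fz)     _ = moves-down
τ-action {suc (suc m)} zero (fs (fs j)) _ = fixed (λ ()) (λ ())
τ-action {suc zero}    zero j           (s≤s ())
τ-action (suc s) fz     _       = fixed (λ ()) (λ ())
τ-action (suc s) (fs j) (s≤s b) with toℕ j | toℕ (τ s j) | τ-action s j b
... | _ | _ | moves-up     = moves-up
... | _ | _ | moves-down   = moves-down
... | _ | _ | fixed ne ne′ = fixed (ne ∘ ℕP.suc-injective) (ne′ ∘ ℕP.suc-injective)

Σ : ∀ {A : Set} → (A → ℤ) → List A → ℤ
Σ f = foldr (λ x acc → f x ℤ.+ acc) (+ 0)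

Σ-cong : ∀ {A : Set} {f h : A → ℤ} → (∀ x → f x ≡ h x) → ∀ l → Σ f l ≡ Σ h l
Σ-cong e []      = refl
Σ-cong e (x ∷ l) = cong₂ ℤ._+_ (e x) (Σ-cong e l)

Σ-zero : ∀ {A : Set} (l : List A) → Σ (λ _ → + 0) l ≡ + 0
Σ-zero []      = refl
Σ-zero (_ ∷ l) = trans (ℤP.+-identityˡ _) (Σ-zero l)

Σ-++ : ∀ {A : Set} (f : A → ℤ) l r → Σ f (l ++ r) ≡ Σ f l ℤ.+ Σ f r
Σ-++ f []      r = sym (ℤP.+-identityˡ _)
Σ-++ f (x ∷ l) r = trans (cong (λ z → f x ℤ.+ z) (Σ-++ f l r)) (sym (ℤP.+-assoc (f x) _ _))

Σ-map : ∀ {A B : Set} (f : B → ℤ) (h : A → B) l → Σ f (map h l) ≡ Σ (f ∘ h) l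
Σ-map f h []      = refl
Σ-map f h (x ∷ l) = cong (λ z → f (h x) ℤ.+ z) (Σ-map f h l)

Σ-concatMap : ∀ {A B : Set} (f : B → ℤ) (h : A → List B) l →
  Σ f (concatMap h l) ≡ Σ (λ x → Σ f (h x)) l
Σ-concatMap f h []      = refl
Σ-concatMap f h (x ∷ l) = trans (Σ-++ f (h x) _) (cong (λ z → Σ f (h x) ℤ.+ z) (Σ-concatMap f h l))

Σ-+ : ∀ {A : Set} (f h : A → ℤ) l → Σ (λ x → f x ℤ.+ h x) l ≡ Σ f l ℤ.+ Σ h l
Σ-+ f h []      = refl
Σ-+ f h (x ∷ l) = trans (cong (λ z → f x ℤ.+ h x ℤ.+ z) (Σ-+ f h l)) (ℤ-interchange (f x) (h x) _ _)

Σ-neg : ∀ {A : Set} (f : A → ℤ) l → Σ (λ x → - f x) l ≡ - Σ f l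
Σ-neg f []      = refl
Σ-neg f (x ∷ l) = trans (cong (λ z → - f x ℤ.+ z) (Σ-neg f l)) (sym (ℤP.neg-distrib-+ (f x) _))

Σ-comm : ∀ {A B : Set} (h : A → B → ℤ) (as : List A) (bs : List B) →
  Σ (λ x → Σ (h x) bs) as ≡ Σ (λ y → Σ (λ x → h x y) as) bs
Σ-comm h []       bs = sym (Σ-zero bs)
Σ-comm h (a ∷ as) bs = trans (cong (λ z → Σ (h a) bs ℤ.+ z) (Σ-comm h as bs)) (sym (Σ-+ (h a) _ bs))

Σ-filter : ∀ {A : Set} (f : A → ℤ) (b : A → Bool) l →
  Σ f (filter (λ x → B.T? (b x)) l) ≡ Σ (λ x → if b x then f x else + 0) l
Σ-filter f b []      = refl
Σ-filter f b (x ∷ l) with b x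
... | true  = cong (λ z → f x ℤ.+ z) (Σ-filter f b l)
... | false = trans (Σ-filter f b l) (sym (ℤP.+-identityˡ _))

Σ-words-suc : ∀ n m (G : Vec (Fin n) (suc m) → ℤ) →
  Σ G (allWords n (suc m)) ≡ Σ (λ x → Σ (λ w → G (x ∷ w)) (allWords n m)) (allFin n)
Σ-words-suc n m G = trans (Σ-concatMap G _ (allFin n)) (Σ-cong (λ x → Σ-map G (x ∷_) (allWords n m)) (allFin n))

-- Exchanging two adjacent letters is a bijection of the set of all words,
-- so it does not change a sum over all words.
Σ-words-swap : ∀ n m s (F : Vec (Fin n) m → ℤ) →
  Σ (F ∘ swapᵛ s) (allWords n m) ≡ Σ F (allWords n m)
Σ-words-swap n zero s F = cong (λ z → z ℤ.+ + 0) (swap-nil s)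
  where
  swap-nil : ∀ s → F (swapᵛ s []) ≡ F []
  swap-nil zero    = refl
  swap-nil (suc s) = refl
Σ-words-swap n (suc zero) zero F = Σ-cong swap-single (allWords n 1)
  where
  swap-single : ∀ (w : Vec (Fin n) 1) → F (swapᵛ zero w) ≡ F w
  swap-single (x ∷ []) = refl
Σ-words-swap n (suc m) (suc s) F = begin
  Σ (F ∘ swapᵛ (suc s)) (allWords n (suc m))
    ≡⟨ Σ-words-suc n m (F ∘ swapᵛ (suc s)) ⟩
  Σ (λ x → Σ (λ w → F (x ∷ swapᵛ s w)) (allWords n m)) (allFin n)
    ≡⟨ Σ-cong (λ x → Σ-words-swap n m s (λ w → F (x ∷ w))) (allFin n) ⟩
  Σ (λ x → Σ (λ w → F (x ∷ w)) (allWords n m)) (allFin n)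
    ≡⟨ Σ-words-suc n m F ⟨
  Σ F (allWords n (suc m)) ∎
  where open ≡-Reasoning
Σ-words-swap n (suc (suc m)) zero F = begin
  Σ (F ∘ swapᵛ zero) (allWords n (suc (suc m)))
    ≡⟨ Σ-by-two-heads (F ∘ swapᵛ zero) ⟩
  Σ (λ x → Σ (λ y → Σ (λ v → F (y ∷ x ∷ v)) (allWords n m)) (allFin n)) (allFin n)
    ≡⟨ Σ-comm (λ x y → Σ (λ v → F (y ∷ x ∷ v)) (allWords n m)) (allFin n) (allFin n) ⟩
  Σ (λ y → Σ (λ x → Σ (λ v → F (y ∷ x ∷ v)) (allWords n m)) (allFin n)) (allFin n)
    ≡⟨ Σ-by-two-heads F ⟨
  Σ F (allWords n (suc (suc m))) ∎
  where
  open ≡-Reasoning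
  Σ-by-two-heads : ∀ (G : Vec (Fin n) (suc (suc m)) → ℤ) → Σ G (allWords n (suc (suc m))) ≡
    Σ (λ x → Σ (λ y → Σ (λ v → G (x ∷ y ∷ v)) (allWords n m)) (allFin n)) (allFin n)
  Σ-by-two-heads G = trans (Σ-words-suc n (suc m) G) (Σ-cong (λ x → Σ-words-suc n m (λ w → G (x ∷ w))) (allFin n))

x≡-x⇒x≡0 : ∀ (x : ℤ) → x ≡ - x → x ≡ + 0
x≡-x⇒x≡0 (+ zero)  _  = refl
x≡-x⇒x≡0 (+ suc n) ()
x≡-x⇒x≡0 -[1+ n ]  ()

Σ-antisymmetric : ∀ n m s (F : Vec (Fin n) m → ℤ) → (∀ w → F (swapᵛ s w) ≡ - F w) →
  Σ F (allWords n m) ≡ + 0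
Σ-antisymmetric n m s F anti = x≡-x⇒x≡0 _ (begin
  Σ F (allWords n m)             ≡⟨ Σ-words-swap n m s F ⟨
  Σ (F ∘ swapᵛ s) (allWords n m) ≡⟨ Σ-cong anti (allWords n m) ⟩
  Σ (λ w → - F w) (allWords n m) ≡⟨ Σ-neg F (allWords n m) ⟩
  - Σ F (allWords n m)           ∎)
  where open ≡-Reasoning

Σᵢ : ℕ → (ℕ → ℤ) → ℤ
Σᵢ zero    h = + 0
Σᵢ (suc K) h = h 0 ℤ.+ Σᵢ K (h ∘ suc)

Σᵢ-vanishing : ∀ K (h : ℕ → ℤ) → (∀ i → i < K → h i ≡ + 0) → Σᵢ K h ≡ + 0
Σᵢ-vanishing zero    h e = refl
Σᵢ-vanishing (suc K) h e =
  cong₂ ℤ._+_ (e 0 (s≤s z≤n)) (Σᵢ-vanishing K (h ∘ suc) (λ i i<K → e (suc i) (s≤s i<K)))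

Σᵢ-+ : ∀ K (a b : ℕ → ℤ) → Σᵢ K (λ i → a i ℤ.+ b i) ≡ Σᵢ K a ℤ.+ Σᵢ K b
Σᵢ-+ zero    a b = refl
Σᵢ-+ (suc K) a b =
  trans (cong (λ z → a 0 ℤ.+ b 0 ℤ.+ z) (Σᵢ-+ K (a ∘ suc) (b ∘ suc))) (ℤ-interchange (a 0) (b 0) _ _)

Σᵢ-*ˡ : ∀ K z (h : ℕ → ℤ) → z ℤ.* Σᵢ K h ≡ Σᵢ K (λ i → z ℤ.* h i)
Σᵢ-*ˡ zero    z h = ℤP.*-zeroʳ z
Σᵢ-*ˡ (suc K) z h =
  trans (ℤP.*-distribˡ-+ z (h 0) _) (cong (λ q → z ℤ.* h 0 ℤ.+ q) (Σᵢ-*ˡ K z (h ∘ suc)))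

Σ-Σᵢ : ∀ {A : Set} K (h : A → ℕ → ℤ) l →
  Σ (λ x → Σᵢ K (h x)) l ≡ Σᵢ K (λ i → Σ (λ x → h x i) l)
Σ-Σᵢ K h []      = sym (Σᵢ-vanishing K _ (λ _ _ → refl))
Σ-Σᵢ K h (x ∷ l) = trans (cong (λ q → Σᵢ K (h x) ℤ.+ q) (Σ-Σᵢ K h l)) (sym (Σᵢ-+ K (h x) _))

δ : ∀ {n} → Face n → Face n → ℤ
δ ρ t = if does (t ≟Face ρ) then + 1 else + 0

sgn : ℕ → ℤ
sgn i = (- (+ 1)) ℤ.^ i

-- The i-th face of a list of faces (with a dummy value out of range), and
-- merge i t: the face obtained from t by merging its blocks i and i+1.
nthFace : ∀ {n} → ℕ → List (Face n) → Face n
nthFace i       []       = []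
nthFace zero    (t ∷ ts) = t
nthFace (suc i) (t ∷ ts) = nthFace i ts

merge : ∀ {n} → ℕ → Face n → Face n
merge i t = nthFace i (merges t)

nthFace-map : ∀ {n} (h : Face n → Face n) i (ts : List (Face n)) → i < length ts →
  nthFace i (map h ts) ≡ h (nthFace i ts)
nthFace-map h zero    (t ∷ ts) _       = refl
nthFace-map h (suc i) (t ∷ ts) (s≤s p) = nthFace-map h i ts p

length-merges : ∀ {n} (t : Face n) → length (merges t) ≡ ℕ.pred (length t)
length-merges []          = refl
length-merges (a ∷ [])    = refl
length-merges (a ∷ b ∷ t) = cong suc (trans (LP.length-map (a ∷_) (merges (b ∷ t))) (length-merges (b ∷ t)))

length-σ : ∀ {n} (w : List (Fin n)) c → length (σ w c) ≡ length c
length-σ w []      = refl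
length-σ w (x ∷ c) = cong suc (length-σ _ c)

module _ {n : ℕ} (ρ : Face n) where

  coeff-∷ : ∀ z t ch → coeff ρ ((z , t) ∷ ch) ≡ z ℤ.* δ ρ t ℤ.+ coeff ρ ch
  coeff-∷ z t ch with does (t ≟Face ρ)
  ... | true  = cong (ℤ._+ coeff ρ ch) (sym (ℤP.*-identityʳ z))
  ... | false = trans (sym (ℤP.+-identityˡ _)) (cong (ℤ._+ coeff ρ ch) (sym (ℤP.*-zeroʳ z)))

  coeff-++ : ∀ (xs ys : Chain n) → coeff ρ (xs ++ ys) ≡ coeff ρ xs ℤ.+ coeff ρ ys
  coeff-++ []             ys = sym (ℤP.+-identityˡ _)
  coeff-++ ((z , t) ∷ xs) ys = begin
    coeff ρ ((z , t) ∷ xs ++ ys)                    ≡⟨ coeff-∷ z t (xs ++ ys) ⟩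
    z ℤ.* δ ρ t ℤ.+ coeff ρ (xs ++ ys)              ≡⟨ cong (λ q → z ℤ.* δ ρ t ℤ.+ q) (coeff-++ xs ys) ⟩
    z ℤ.* δ ρ t ℤ.+ (coeff ρ xs ℤ.+ coeff ρ ys)     ≡⟨ ℤP.+-assoc (z ℤ.* δ ρ t) _ _ ⟨
    z ℤ.* δ ρ t ℤ.+ coeff ρ xs ℤ.+ coeff ρ ys       ≡⟨ cong (ℤ._+ coeff ρ ys) (coeff-∷ z t xs) ⟨
    coeff ρ ((z , t) ∷ xs) ℤ.+ coeff ρ ys           ∎
    where open ≡-Reasoning

  coeff-concatMap : ∀ {A : Set} (h : A → Chain n) l → coeff ρ (concatMap h l) ≡ Σ (λ x → coeff ρ (h x)) l
  coeff-concatMap h []      = refl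
  coeff-concatMap h (x ∷ l) =
    trans (coeff-++ (h x) (concatMap h l)) (cong (λ q → coeff ρ (h x) ℤ.+ q) (coeff-concatMap h l))

  coeff-scale : ∀ z (ch : Chain n) → coeff ρ (map (λ { (s , t) → (z ℤ.* s , t) }) ch) ≡ z ℤ.* coeff ρ ch
  coeff-scale z []             = sym (ℤP.*-zeroʳ z)
  coeff-scale z ((s , t) ∷ ch) = begin
    coeff ρ ((z ℤ.* s , t) ∷ _)                            ≡⟨ coeff-∷ _ t _ ⟩
    z ℤ.* s ℤ.* δ ρ t ℤ.+ _                                ≡⟨ cong₂ ℤ._+_ (ℤP.*-assoc z s _) (coeff-scale z ch) ⟩
    z ℤ.* (s ℤ.* δ ρ t) ℤ.+ z ℤ.* coeff ρ ch               ≡⟨ ℤP.*-distribˡ-+ z _ _ ⟨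
    z ℤ.* (s ℤ.* δ ρ t ℤ.+ coeff ρ ch)                     ≡⟨ cong (z ℤ.*_) (coeff-∷ s t ch) ⟨
    z ℤ.* coeff ρ ((s , t) ∷ ch)                           ∎
    where open ≡-Reasoning

  coeff-∂ : ∀ (ch : Chain n) → coeff ρ (∂ ch) ≡ Σ (λ p → proj₁ p ℤ.* coeff ρ (∂face (proj₂ p))) ch
  coeff-∂ ch = trans (coeff-concatMap _ ch) (Σ-cong (λ { (z , t) → coeff-scale z (∂face t) }) ch)

  coeff-∂face : ∀ t → coeff ρ (∂face t) ≡ Σᵢ (length (merges t)) (λ i → sgn i ℤ.* δ ρ (merge i t))
  coeff-∂face t = signed-list id (merges t)
    where
    signed-list : ∀ (f : ℕ → ℕ) ts →
      coeff ρ (zipWith (λ i t → (sgn i , t)) (applyUpTo f (length ts)) ts)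
        ≡ Σᵢ (length ts) (λ i → sgn (f i) ℤ.* δ ρ (nthFace i ts))
    signed-list f []       = refl
    signed-list f (t ∷ ts) =
      trans (coeff-∷ _ t _) (cong (λ q → sgn (f 0) ℤ.* δ ρ t ℤ.+ q) (signed-list (f ∘ suc) ts))

-- Expanding all definitions, the coefficient of ρ in ∂ g_α is a double sum
-- Σ_{i < k-1} Σ_{γ a word} term i γ, where term i γ is the contribution of
-- the i-th merge of σ(α∘γ, c), counted only when γ ∈ 𝔖^c_c.
module Expansion {n : ℕ} (c : List ℕ) (α : Permutation′ n) (ρ : Face n) where

  mergedFace : ℕ → Vec (Fin n) n → Face n
  mergedFace i γ = merge i (σ (compose α γ) c)

  term : ℕ → Vec (Fin n) n → ℤ
  term i γ = if injectiveᵇ γ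
             then (if inColumnGroup c γ then sign γ ℤ.* (sgn i ℤ.* δ ρ (mergedFace i γ)) else + 0)
             else + 0

  K : ℕ
  K = ℕ.pred (length c)

  coeff-∂g : coeff ρ (∂ (g c α)) ≡ Σᵢ K (λ i → Σ (term i) (allWords n n))
  coeff-∂g = begin
    coeff ρ (∂ (g c α))
      ≡⟨ coeff-∂ ρ (g c α) ⟩
    Σ (λ p → proj₁ p ℤ.* coeff ρ (∂face (proj₂ p))) (g c α)
      ≡⟨ Σ-map (λ p → proj₁ p ℤ.* coeff ρ (∂face (proj₂ p))) (λ γ → (sign γ , σ (compose α γ) c)) columnWords ⟩
    Σ (λ γ → sign γ ℤ.* coeff ρ (∂face (σ (compose α γ) c))) columnWords
      ≡⟨ Σ-cong (λ γ → cong (sign γ ℤ.*_) (expand-face γ)) columnWords ⟩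
    Σ summand columnWords
      ≡⟨ Σ-filter summand (inColumnGroup c) (Sym n) ⟩
    Σ (λ γ → if inColumnGroup c γ then summand γ else + 0) (Sym n)
      ≡⟨ Σ-filter _ injectiveᵇ (allWords n n) ⟩
    Σ (λ γ → if injectiveᵇ γ then (if inColumnGroup c γ then summand γ else + 0) else + 0) (allWords n n)
      ≡⟨ Σ-cong distribute (allWords n n) ⟩
    Σ (λ γ → Σᵢ K (λ i → term i γ)) (allWords n n)
      ≡⟨ Σ-Σᵢ K (λ γ i → term i γ) (allWords n n) ⟩
    Σᵢ K (λ i → Σ (term i) (allWords n n)) ∎
    where
    open ≡-Reasoning
    columnWords : List (Vec (Fin n) n)
    columnWords = filter (λ γ → B.T? (inColumnGroup c γ)) (Sym n)

    summand : Vec (Fin n) n → ℤ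
    summand γ = sign γ ℤ.* Σᵢ K (λ i → sgn i ℤ.* δ ρ (mergedFace i γ))

    expand-face : ∀ γ → coeff ρ (∂face (σ (compose α γ) c)) ≡ Σᵢ K (λ i → sgn i ℤ.* δ ρ (mergedFace i γ))
    expand-face γ = trans (coeff-∂face ρ (σ (compose α γ) c))
      (cong (λ k → Σᵢ k (λ i → sgn i ℤ.* δ ρ (mergedFace i γ)))
            (trans (length-merges (σ (compose α γ) c)) (cong ℕ.pred (length-σ (compose α γ) c))))

    distribute : ∀ γ → (if injectiveᵇ γ then (if inColumnGroup c γ then summand γ else + 0) else + 0)
                       ≡ Σᵢ K (λ i → term i γ)
    distribute γ with injectiveᵇ γ | inColumnGroup c γ
    ... | true  | true  = Σᵢ-*ˡ K (sign γ) _
    ... | true  | false = sym (Σᵢ-vanishing K _ (λ _ _ → refl))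
    ... | false | _     = sym (Σᵢ-vanishing K _ (λ _ _ → refl))

≡ᵇ-refl : ∀ x → (x ≡ᵇ x) ≡ true
≡ᵇ-refl x = dec-true (x ℕP.≟ x) refl

≢⇒≡ᵇ-false : ∀ {x y} → x ≢ y → (x ≡ᵇ y) ≡ false
≢⇒≡ᵇ-false {x} {y} = dec-false (x ℕP.≟ y)

<⇒<ᵇ-true : ∀ {x y} → x < y → (x <ᵇ y) ≡ true
<⇒<ᵇ-true {x} {y} = dec-true (x ℕP.<? y)

≮⇒<ᵇ-false : ∀ {x y} → ¬ x < y → (x <ᵇ y) ≡ false
≮⇒<ᵇ-false {x} {y} = dec-false (x ℕP.<? y)

n≡ᵇ1+n : ∀ s → (s ≡ᵇ suc s) ≡ false
n≡ᵇ1+n s = ≢⇒≡ᵇ-false (ℕP.<⇒≢ (ℕP.n<1+n s))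

1+n≡ᵇn : ∀ s → (suc s ≡ᵇ s) ≡ false
1+n≡ᵇn s = ≢⇒≡ᵇ-false (ℕP.<⇒≢ (ℕP.n<1+n s) ∘ sym)

n<ᵇ1+n : ∀ s → (s <ᵇ suc s) ≡ true
n<ᵇ1+n s = <⇒<ᵇ-true (ℕP.n<1+n s)

1+n<ᵇn : ∀ s → (suc s <ᵇ s) ≡ false
1+n<ᵇn s = ≮⇒<ᵇ-false (ℕP.<-asym (ℕP.n<1+n s))

suc-<ᵇ-skip : ∀ s b → b ≢ s → b ≢ suc s → (suc s <ᵇ b) ≡ (s <ᵇ b)
suc-<ᵇ-skip s b b≢s b≢1+s =
  does-⇔ (mk⇔ (ℕP.<-trans (ℕP.n<1+n s)) (λ s<b → ℕP.≤∧≢⇒< s<b (b≢1+s ∘ sym))) (suc s ℕP.<? b) (s ℕP.<? b)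

<ᵇ-suc-skip : ∀ s a → a ≢ s → (a <ᵇ suc s) ≡ (a <ᵇ s)
<ᵇ-suc-skip s a a≢s =
  does-⇔ (mk⇔ (λ a<1+s → ℕP.≤∧≢⇒< (ℕP.≤-pred a<1+s) a≢s) (λ a<s → ℕP.<-trans a<s (ℕP.n<1+n s)))
    (a ℕP.<? suc s) (a ℕP.<? s)

ind : Bool → ℕ
ind b = if b then 1 else 0

pairAt : ℕ → ℕ → ℕ → ℕ → Bool → ℕ
pairAt a b x y q = if x ≡ᵇ a then (if y ≡ᵇ b then ind q else 0) else 0

-- τ s preserves the relative order of two indices, except that it reverses
-- the pair (s, s+1); the correction terms account for exactly that pair.
order-under-τ : ∀ {s x y x' y'} q → τ-Action s x x' → τ-Action s y y' →
  ind ((x' <ᵇ y') ∧ q) + pairAt s (suc s) x y q ≡ ind ((x <ᵇ y) ∧ q) + pairAt (suc s) s x y q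
order-under-τ {s} q moves-up moves-up
  rewrite ≡ᵇ-refl s | n≡ᵇ1+n s = refl
order-under-τ {s} q moves-up moves-down
  rewrite ≡ᵇ-refl s | n≡ᵇ1+n s | n<ᵇ1+n s | 1+n<ᵇn s = ℕP.+-comm 0 (ind q)
order-under-τ {s} q moves-up (fixed {y} y≢s y≢1+s)
  rewrite ≡ᵇ-refl s | n≡ᵇ1+n s | ≢⇒≡ᵇ-false y≢1+s | suc-<ᵇ-skip s y y≢s y≢1+s = refl
order-under-τ {s} q moves-down moves-up
  rewrite ≡ᵇ-refl s | 1+n≡ᵇn s | n<ᵇ1+n s | 1+n<ᵇn s = ℕP.+-comm (ind q) 0
order-under-τ {s} q moves-down moves-down
  rewrite ≡ᵇ-refl (suc s) | 1+n≡ᵇn s = refl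
order-under-τ {s} q moves-down (fixed {y} y≢s y≢1+s)
  rewrite ≡ᵇ-refl (suc s) | 1+n≡ᵇn s | ≢⇒≡ᵇ-false y≢s | suc-<ᵇ-skip s y y≢s y≢1+s = refl
order-under-τ {s} q (fixed {x} x≢s x≢1+s) moves-up
  rewrite ≢⇒≡ᵇ-false x≢s | ≢⇒≡ᵇ-false x≢1+s | <ᵇ-suc-skip s x x≢s = refl
order-under-τ {s} q (fixed {x} x≢s x≢1+s) moves-down
  rewrite ≢⇒≡ᵇ-false x≢s | ≢⇒≡ᵇ-false x≢1+s | <ᵇ-suc-skip s x x≢s = refl
order-under-τ {s} q (fixed x≢s x≢1+s) (fixed _ _)
  rewrite ≢⇒≡ᵇ-false x≢s | ≢⇒≡ᵇ-false x≢1+s = refl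

ΣFin : ∀ {m} → (Fin m → ℕ) → ℕ
ΣFin {m} f = sum (map f (allFin m))

ΣFin-cong : ∀ {m} {f h : Fin m → ℕ} → (∀ i → f i ≡ h i) → ΣFin f ≡ ΣFin h
ΣFin-cong {m} e = cong sum (LP.map-cong e (allFin m))

ΣFin-+ : ∀ {m} (f h : Fin m → ℕ) → ΣFin (λ i → f i + h i) ≡ ΣFin f + ΣFin h
ΣFin-+ {m} f h = sum-map-+ (allFin m)
  where
  sum-map-+ : ∀ l → sum (map (λ i → f i + h i) l) ≡ sum (map f l) + sum (map h l)
  sum-map-+ []      = refl
  sum-map-+ (i ∷ l) = trans (cong (λ z → f i + h i + z) (sum-map-+ l)) (ℕ-interchange (f i) (h i) _ _)

ΣFin-if : ∀ {m} b (f : Fin m → ℕ) → ΣFin (λ j → if b then f j else 0) ≡ (if b then ΣFin f else 0)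
ΣFin-if         true  f = refl
ΣFin-if {m = m} false f = zeros (allFin m)
  where
  zeros : ∀ (l : List (Fin m)) → sum (map (λ _ → 0) l) ≡ 0
  zeros []      = refl
  zeros (_ ∷ l) = zeros l

ΣFin-point : ∀ {m} (f : Fin m → ℕ) (a : Fin m) → ΣFin (λ j → if toℕ j ≡ᵇ toℕ a then f j else 0) ≡ f a
ΣFin-point f a = trans (cong sum (LP.map-tabulate id (λ j → if toℕ j ≡ᵇ toℕ a then f j else 0))) (point f a)
  where
  zeros : ∀ m → sum (tabulate {n = m} (λ _ → 0)) ≡ 0
  zeros zero    = refl
  zeros (suc m) = zeros m
  point : ∀ {m} (f : Fin m → ℕ) (a : Fin m) → sum (tabulate (λ j → if toℕ j ≡ᵇ toℕ a then f j else 0)) ≡ f a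
  point {suc m} f fz     = trans (cong (λ z → f fz + z) (zeros m)) (ℕP.+-identityʳ _)
  point {suc m} f (fs a) = point (f ∘ fs) a

count-filter : ∀ {A : Set} (b : A → Bool) l → length (filter (λ x → B.T? (b x)) l) ≡ sum (map (ind ∘ b) l)
count-filter b []      = refl
count-filter b (x ∷ l) with b x
... | true  = cong suc (count-filter b l)
... | false = count-filter b l

inversions-as-sum : ∀ {n} (w : Vec (Fin n) n) →
  inversions w ≡ ΣFin (λ i → ΣFin (λ j → ind ((toℕ i <ᵇ toℕ j) ∧ (toℕ (lookup w j) <ᵇ toℕ (lookup w i)))))
inversions-as-sum {n} w =
  ΣFin-cong (λ i → count-filter (λ j → (toℕ i <ᵇ toℕ j) ∧ (toℕ (lookup w j) <ᵇ toℕ (lookup w i))) (allFin n))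

opposite-parity : ∀ a b y → a + ind (not y) ≡ b + ind y → (- (+ 1)) ℤ.^ a ≡ - ((- (+ 1)) ℤ.^ b)
opposite-parity a b true  e = trans (cong ((- (+ 1)) ℤ.^_) a≡1+b) (ℤP.-1*i≡-i _)
  where
  a≡1+b : a ≡ suc b
  a≡1+b = trans (sym (ℕP.+-identityʳ a)) (trans e (ℕP.+-comm b 1))
opposite-parity a b false e =
  trans (sym (ℤP.neg-involutive _)) (cong -_ (trans (sym (ℤP.-1*i≡-i _)) (cong ((- (+ 1)) ℤ.^_) 1+a≡b)))
  where
  1+a≡b : suc a ≡ b
  1+a≡b = trans (ℕP.+-comm 1 a) (trans e (ℕP.+-identityʳ b))

<ᵇ-flip : ∀ u v → u ≢ v → (v <ᵇ u) ≡ not (u <ᵇ v)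
<ᵇ-flip u v u≢v with ℕP.<-cmp u v
... | tri< u<v _ _ rewrite <⇒<ᵇ-true u<v | ≮⇒<ᵇ-false (ℕP.<-asym u<v) = refl
... | tri≈ _ u≡v _ = ⊥-elim (u≢v u≡v)
... | tri> _ _ v<u rewrite <⇒<ᵇ-true v<u | ≮⇒<ᵇ-false (ℕP.<-asym v<u) = refl

injective-distinct : ∀ {n} (w : Vec (Fin n) n) → injectiveᵇ w ≡ true →
  ∀ i j → toℕ i ≢ toℕ j → toℕ (lookup w i) ≢ toℕ (lookup w j)
injective-distinct {n} w inj i j i≢j wi≡wj =
  subst T (cong₂ (λ a b → a ∨ not b) (≢⇒≡ᵇ-false i≢j) (dec-true (_ ℕP.≟ _) wi≡wj)) entry
  where
  entry : T ((toℕ i ≡ᵇ toℕ j) ∨ not (toℕ (lookup w i) ≡ᵇ toℕ (lookup w j)))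
  entry = All.lookup (all⁺ _ (allFin n) (All.lookup (all⁺ _ (allFin n) (Equivalence.from BP.T-≡ inj))
            (∈-allFin i))) (∈-allFin j)

module SignOfSwap {n : ℕ} (s : ℕ) (w : Vec (Fin n) n) (bound : suc s < n) where

  a₀ a₁ : Fin n
  a₀ = fromℕ< (ℕP.<-trans (ℕP.n<1+n s) bound)
  a₁ = fromℕ< bound

  Q : Fin n → Fin n → Bool
  Q i j = toℕ (lookup w j) <ᵇ toℕ (lookup w i)

  ΣΣ : (Fin n → Fin n → ℕ) → ℕ
  ΣΣ f = ΣFin (λ i → ΣFin (λ j → f i j))

  ΣΣ-+ : (f h : Fin n → Fin n → ℕ) → ΣΣ (λ i j → f i j + h i j) ≡ ΣΣ f + ΣΣ h
  ΣΣ-+ f h = trans (ΣFin-cong (λ i → ΣFin-+ (f i) (h i))) (ΣFin-+ (λ i → ΣFin (f i)) (λ i → ΣFin (h i)))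

  inversions-swap : inversions (swapᵛ s w) ≡ ΣΣ (λ i j → ind ((toℕ (τ s i) <ᵇ toℕ (τ s j)) ∧ Q i j))
  inversions-swap = begin
    inversions (swapᵛ s w)
      ≡⟨ inversions-as-sum (swapᵛ s w) ⟩
    ΣΣ (λ i j → ind ((toℕ i <ᵇ toℕ j) ∧ (toℕ (lookup (swapᵛ s w) j) <ᵇ toℕ (lookup (swapᵛ s w) i))))
      ≡⟨ ΣFin-cong (λ i → ΣFin-cong (λ j → cong₂ (λ a b → ind ((toℕ i <ᵇ toℕ j) ∧ (toℕ a <ᵇ toℕ b)))
           (lookup-swapᵛ s w j) (lookup-swapᵛ s w i))) ⟩
    ΣΣ (λ i j → ind ((toℕ i <ᵇ toℕ j) ∧ Q (τ s i) (τ s j)))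
      ≡⟨ sum-reindex s (λ i → ΣFin (λ j → ind ((toℕ i <ᵇ toℕ j) ∧ Q (τ s i) (τ s j)))) ⟨
    ΣΣ (λ i j → ind ((toℕ (τ s i) <ᵇ toℕ j) ∧ Q (τ s (τ s i)) (τ s j)))
      ≡⟨ ΣFin-cong (λ i → sum-reindex s (λ j → ind ((toℕ (τ s i) <ᵇ toℕ j) ∧ Q (τ s (τ s i)) (τ s j)))) ⟨
    ΣΣ (λ i j → ind ((toℕ (τ s i) <ᵇ toℕ (τ s j)) ∧ Q (τ s (τ s i)) (τ s (τ s j))))
      ≡⟨ ΣFin-cong (λ i → ΣFin-cong (λ j → cong₂ (λ a b → ind ((toℕ (τ s i) <ᵇ toℕ (τ s j)) ∧ Q a b))
           (τ-involutive s i) (τ-involutive s j))) ⟩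
    ΣΣ (λ i j → ind ((toℕ (τ s i) <ᵇ toℕ (τ s j)) ∧ Q i j)) ∎
    where open ≡-Reasoning

  ΣΣ-pairAt : ∀ (i₀ j₀ : Fin n) →
    ΣΣ (λ i j → pairAt (toℕ i₀) (toℕ j₀) (toℕ i) (toℕ j) (Q i j)) ≡ ind (Q i₀ j₀)
  ΣΣ-pairAt i₀ j₀ = begin
    ΣΣ (λ i j → pairAt (toℕ i₀) (toℕ j₀) (toℕ i) (toℕ j) (Q i j))
      ≡⟨ ΣFin-cong (λ i → ΣFin-if (toℕ i ≡ᵇ toℕ i₀) (at-j₀ i)) ⟩
    ΣFin (λ i → if toℕ i ≡ᵇ toℕ i₀ then ΣFin (at-j₀ i) else 0)
      ≡⟨ ΣFin-point (λ i → ΣFin (at-j₀ i)) i₀ ⟩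
    ΣFin (at-j₀ i₀)
      ≡⟨ ΣFin-point (λ j → ind (Q i₀ j)) j₀ ⟩
    ind (Q i₀ j₀) ∎
    where
    open ≡-Reasoning
    at-j₀ : Fin n → Fin n → ℕ
    at-j₀ i j = if toℕ j ≡ᵇ toℕ j₀ then ind (Q i j) else 0

  ΣΣ-pairAt-τ : ∀ (i₀ j₀ : Fin n) {x y} → toℕ i₀ ≡ x → toℕ j₀ ≡ y →
    ΣΣ (λ i j → pairAt x y (toℕ i) (toℕ j) (Q i j)) ≡ ind (Q i₀ j₀)
  ΣΣ-pairAt-τ i₀ j₀ refl refl = ΣΣ-pairAt i₀ j₀

  inversions-step : inversions (swapᵛ s w) + ind (Q a₀ a₁) ≡ inversions w + ind (Q a₁ a₀)
  inversions-step = begin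
    inversions (swapᵛ s w) + ind (Q a₀ a₁)
      ≡⟨ cong₂ _+_ inversions-swap (sym (ΣΣ-pairAt-τ a₀ a₁ e₀ e₁)) ⟩
    ΣΣ (λ i j → ind ((toℕ (τ s i) <ᵇ toℕ (τ s j)) ∧ Q i j))
      + ΣΣ (λ i j → pairAt s (suc s) (toℕ i) (toℕ j) (Q i j))
      ≡⟨ ΣΣ-+ _ _ ⟨
    ΣΣ (λ i j → ind ((toℕ (τ s i) <ᵇ toℕ (τ s j)) ∧ Q i j) + pairAt s (suc s) (toℕ i) (toℕ j) (Q i j))
      ≡⟨ ΣFin-cong (λ i → ΣFin-cong (λ j → order-under-τ (Q i j) (τ-action s i bound) (τ-action s j bound))) ⟩
    ΣΣ (λ i j → ind ((toℕ i <ᵇ toℕ j) ∧ Q i j) + pairAt (suc s) s (toℕ i) (toℕ j) (Q i j))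
      ≡⟨ ΣΣ-+ _ _ ⟩
    ΣΣ (λ i j → ind ((toℕ i <ᵇ toℕ j) ∧ Q i j))
      + ΣΣ (λ i j → pairAt (suc s) s (toℕ i) (toℕ j) (Q i j))
      ≡⟨ cong₂ _+_ (sym (inversions-as-sum w)) (ΣΣ-pairAt-τ a₁ a₀ e₁ e₀) ⟩
    inversions w + ind (Q a₁ a₀) ∎
    where
    open ≡-Reasoning
    e₀ : toℕ a₀ ≡ s
    e₀ = FP.toℕ-fromℕ< _
    e₁ : toℕ a₁ ≡ suc s
    e₁ = FP.toℕ-fromℕ< _

  sign-swap : injectiveᵇ w ≡ true → sign (swapᵛ s w) ≡ - sign w
  sign-swap inj = opposite-parity (inversions (swapᵛ s w)) (inversions w) (Q a₁ a₀)
    (subst (λ b → inversions (swapᵛ s w) + ind b ≡ inversions w + ind (Q a₁ a₀)) Q₀₁≡¬Q₁₀ inversions-step)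
    where
    Q₀₁≡¬Q₁₀ : Q a₀ a₁ ≡ not (Q a₁ a₀)
    Q₀₁≡¬Q₁₀ = <ᵇ-flip _ _ (injective-distinct w inj a₀ a₁
      (λ eq → ℕP.<⇒≢ (ℕP.n<1+n s) (trans (sym (FP.toℕ-fromℕ< _)) (trans eq (FP.toℕ-fromℕ< _)))))

all-cong : ∀ {A : Set} {p q : A → Bool} → (∀ x → p x ≡ q x) → ∀ l → all p l ≡ all q l
all-cong e l = cong (foldr _∧_ true) (LP.map-cong e l)

all²-reindex : ∀ {m} s (p : Fin m → Fin m → Bool) →
  all (λ i → all (λ j → p (τ s i) (τ s j)) (allFin m)) (allFin m) ≡ all (λ i → all (p i) (allFin m)) (allFin m)
all²-reindex {m} s p =
  trans (all-cong (λ i → all-reindex s (p (τ s i))) (allFin m)) (all-reindex s (λ i → all (p i) (allFin m)))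

≡ᵇ-τ : ∀ {m} s (i j : Fin m) → (toℕ (τ s i) ≡ᵇ toℕ (τ s j)) ≡ (toℕ i ≡ᵇ toℕ j)
≡ᵇ-τ s i j = does-⇔ (mk⇔ τ-cancel (cong (toℕ ∘ τ s) ∘ FP.toℕ-injective))
  (toℕ (τ s i) ℕP.≟ toℕ (τ s j)) (toℕ i ℕP.≟ toℕ j)
  where
  τ-cancel : toℕ (τ s i) ≡ toℕ (τ s j) → toℕ i ≡ toℕ j
  τ-cancel eq = cong toℕ (trans (sym (τ-involutive s i))
    (trans (cong (τ s) (FP.toℕ-injective eq)) (τ-involutive s j)))

injective-swap : ∀ {n} s (w : Vec (Fin n) n) → injectiveᵇ (swapᵛ s w) ≡ injectiveᵇ w
injective-swap {n} s w = begin
  injectiveᵇ (swapᵛ s w)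
    ≡⟨ all-cong (λ i → all-cong (λ j → cong₂ (λ a b → (toℕ i ≡ᵇ toℕ j) ∨ not (toℕ a ≡ᵇ toℕ b))
         (lookup-swapᵛ s w i) (lookup-swapᵛ s w j)) (allFin n)) (allFin n) ⟩
  all (λ i → all (λ j → (toℕ i ≡ᵇ toℕ j) ∨ differ (τ s i) (τ s j)) (allFin n)) (allFin n)
    ≡⟨ all-cong (λ i → all-cong (λ j → cong (_∨ differ (τ s i) (τ s j)) (≡ᵇ-τ s i j)) (allFin n)) (allFin n) ⟨
  all (λ i → all (λ j → (toℕ (τ s i) ≡ᵇ toℕ (τ s j)) ∨ differ (τ s i) (τ s j)) (allFin n)) (allFin n)
    ≡⟨ all²-reindex s (λ i j → (toℕ i ≡ᵇ toℕ j) ∨ differ i j) ⟩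
  injectiveᵇ w ∎
  where
  open ≡-Reasoning
  differ : Fin n → Fin n → Bool
  differ i j = not (toℕ (lookup w i) ≡ᵇ toℕ (lookup w j))

-- cutsFrom c a k: all of a, a+1, …, a+k-1 are cuts of c, i.e. a and a+k lie
-- in the same column interval; this is how sameColumn is computed.
cutsFrom : List ℕ → ℕ → ℕ → Bool
cutsFrom c a k = all (isCut c) (applyUpTo (λ i → a + i) k)

sameColumn-≤ : ∀ c {a b} → a ≤ b → sameColumn c a b ≡ cutsFrom c a (b ∸ a)
sameColumn-≤ c {a} {b} a≤b with a ≤ᵇ b | dec-true (a ℕP.≤? b) a≤b
... | true | _ = refl

sameColumn-> : ∀ c {a b} → b < a → sameColumn c a b ≡ cutsFrom c b (a ∸ b)
sameColumn-> c {a} {b} b<a with a ≤ᵇ b | dec-false (a ℕP.≤? b) (ℕP.<⇒≱ b<a)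
... | false | _ = refl

cutsFrom-head : ∀ c a k → cutsFrom c a (suc k) ≡ isCut c a ∧ cutsFrom c (suc a) k
cutsFrom-head c a k = cong₂ (λ x xs → all (isCut c) (x ∷ xs)) (ℕP.+-identityʳ a) (shifted (λ i → ℕP.+-suc a i) k)
  where
  shifted : ∀ {f h : ℕ → ℕ} → (∀ i → f i ≡ h i) → ∀ k → applyUpTo f k ≡ applyUpTo h k
  shifted e zero    = refl
  shifted e (suc k) = cong₂ _∷_ (e 0) (shifted (e ∘ suc) k)

cutsFrom-last : ∀ c a k → cutsFrom c a (suc k) ≡ cutsFrom c a k ∧ isCut c (a + k)
cutsFrom-last c a k = all-snoc (λ i → a + i) k
  where
  all-snoc : ∀ (f : ℕ → ℕ) k → all (isCut c) (applyUpTo f (suc k)) ≡ all (isCut c) (applyUpTo f k) ∧ isCut c (f k)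
  all-snoc f zero    = BP.∧-identityʳ (isCut c (f 0))
  all-snoc f (suc k) = trans (cong (isCut c (f 0) ∧_) (all-snoc (f ∘ suc) k)) (sym (BP.∧-assoc (isCut c (f 0)) _ _))

-- If a is a cut then a and a+1 lie in the same column interval, so they are
-- in the same column as exactly the same positions.
sameColumn-across-cut : ∀ c a → isCut c a ≡ true → ∀ x → sameColumn c a x ≡ sameColumn c (suc a) x
sameColumn-across-cut c a cut x with ℕP.<-cmp a x
... | tri< a<x _ _ = begin
  sameColumn c a x                              ≡⟨ sameColumn-≤ c (ℕP.<⇒≤ a<x) ⟩
  cutsFrom c a (x ∸ a)                          ≡⟨ cong (cutsFrom c a) (ℕP.+-∸-assoc 1 a<x) ⟩
  cutsFrom c a (suc (x ∸ suc a))                ≡⟨ cutsFrom-head c a (x ∸ suc a) ⟩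
  isCut c a ∧ cutsFrom c (suc a) (x ∸ suc a)    ≡⟨ cong (_∧ cutsFrom c (suc a) (x ∸ suc a)) cut ⟩
  cutsFrom c (suc a) (x ∸ suc a)                ≡⟨ sameColumn-≤ c a<x ⟨
  sameColumn c (suc a) x                        ∎
  where open ≡-Reasoning
... | tri≈ _ refl _ = begin
  sameColumn c a a                              ≡⟨ sameColumn-≤ c (ℕP.≤-refl {a}) ⟩
  cutsFrom c a (a ∸ a)                          ≡⟨ cong (cutsFrom c a) (ℕP.n∸n≡0 a) ⟩
  true                                          ≡⟨ cong (_∧ true) cut ⟨
  isCut c a ∧ true                              ≡⟨ cutsFrom-head c a 0 ⟨
  cutsFrom c a 1                                ≡⟨ cong (cutsFrom c a) (ℕP.m+n∸n≡m 1 a) ⟨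
  cutsFrom c a (suc a ∸ a)                      ≡⟨ sameColumn-> c (ℕP.n<1+n a) ⟨
  sameColumn c (suc a) a                        ∎
  where open ≡-Reasoning
... | tri> _ _ x<a = begin
  sameColumn c a x                              ≡⟨ sameColumn-> c x<a ⟩
  cutsFrom c x (a ∸ x)                          ≡⟨ BP.∧-identityʳ _ ⟨
  cutsFrom c x (a ∸ x) ∧ true                   ≡⟨ cong (cutsFrom c x (a ∸ x) ∧_) (trans (sym cut) (cong (isCut c) (sym (ℕP.m+[n∸m]≡n (ℕP.<⇒≤ x<a))))) ⟩
  cutsFrom c x (a ∸ x) ∧ isCut c (x + (a ∸ x))  ≡⟨ cutsFrom-last c x (a ∸ x) ⟨
  cutsFrom c x (suc (a ∸ x))                    ≡⟨ cong (cutsFrom c x) (ℕP.+-∸-assoc 1 (ℕP.<⇒≤ x<a)) ⟨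
  cutsFrom c x (suc a ∸ x)                      ≡⟨ sameColumn-> c (ℕP.<-trans x<a (ℕP.n<1+n a)) ⟨
  sameColumn c (suc a) x                        ∎
  where open ≡-Reasoning

-- When s+1 is a cut, positions s and s+1 (0-indexed) lie in one column interval,
-- so τ s moves every position within its own column interval.
sameColumn-τ : ∀ {m} c s → isCut c (suc s) ≡ true → suc s < m → ∀ (j : Fin m) x →
  sameColumn c (suc (toℕ (τ s j))) x ≡ sameColumn c (suc (toℕ j)) x
sameColumn-τ c s cut bound j x with toℕ j | toℕ (τ s j) | τ-action s j bound
... | _ | _ | moves-up   = sym (sameColumn-across-cut c (suc s) cut x)
... | _ | _ | moves-down = sameColumn-across-cut c (suc s) cut x
... | _ | _ | fixed _ _  = refl

column-swap : ∀ {n} c s (w : Vec (Fin n) n) → isCut c (suc s) ≡ true → suc s < n →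
  inColumnGroup c (swapᵛ s w) ≡ inColumnGroup c w
column-swap {n} c s w cut bound = begin
  inColumnGroup c (swapᵛ s w)
    ≡⟨ all-cong (λ j → cong (λ a → sameColumn c (suc (toℕ j)) (suc (toℕ a))) (lookup-swapᵛ s w j)) (allFin n) ⟩
  all (λ j → sameColumn c (suc (toℕ j)) (suc (toℕ (lookup w (τ s j))))) (allFin n)
    ≡⟨ all-reindex s (λ j → sameColumn c (suc (toℕ j)) (suc (toℕ (lookup w (τ s j))))) ⟨
  all (λ j → sameColumn c (suc (toℕ (τ s j))) (suc (toℕ (lookup w (τ s (τ s j)))))) (allFin n)
    ≡⟨ all-cong (λ j → cong (λ a → sameColumn c (suc (toℕ (τ s j))) (suc (toℕ (lookup w a)))) (τ-involutive s j)) (allFin n) ⟩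
  all (λ j → sameColumn c (suc (toℕ (τ s j))) (suc (toℕ (lookup w j)))) (allFin n)
    ≡⟨ all-cong (λ j → sameColumn-τ c s cut bound j (suc (toℕ (lookup w j)))) (allFin n) ⟩
  inColumnGroup c w ∎
  where open ≡-Reasoning

take-swap : ∀ {A : Set} s m (l : List A) → suc (suc s) ≤ m → take m (swap s l) ≡ swap s (take m l)
take-swap zero    (suc zero)    l           (s≤s ())
take-swap zero    (suc (suc m)) []          _       = refl
take-swap zero    (suc (suc m)) (x ∷ [])    _       = refl
take-swap zero    (suc (suc m)) (x ∷ y ∷ l) _       = refl
take-swap (suc s) (suc m)       []          _       = refl
take-swap (suc s) (suc m)       (x ∷ l)     (s≤s p) = cong (x ∷_) (take-swap s m l p)

drop-swap : ∀ {A : Set} s m (l : List A) → suc (suc s) ≤ m → drop m (swap s l) ≡ drop m l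
drop-swap zero    (suc zero)    l           (s≤s ())
drop-swap zero    (suc (suc m)) []          _       = refl
drop-swap zero    (suc (suc m)) (x ∷ [])    _       = refl
drop-swap zero    (suc (suc m)) (x ∷ y ∷ l) _       = refl
drop-swap (suc s) (suc m)       []          _       = refl
drop-swap (suc s) (suc m)       (x ∷ l)     (s≤s p) = drop-swap s m l p

take-swap-beyond : ∀ {A : Set} a s (l : List A) → take a (swap (a + s) l) ≡ take a l
take-swap-beyond zero    s l       = refl
take-swap-beyond (suc a) s []      = refl
take-swap-beyond (suc a) s (x ∷ l) = cong (x ∷_) (take-swap-beyond a s l)

drop-swap-beyond : ∀ {A : Set} a s (l : List A) → drop a (swap (a + s) l) ≡ swap s (drop a l)
drop-swap-beyond zero    s       l       = refl
drop-swap-beyond (suc a) zero    []      = refl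
drop-swap-beyond (suc a) (suc s) []      = refl
drop-swap-beyond (suc a) s       (x ∷ l) = drop-swap-beyond a s l

module _ {n : ℕ} where

  letters-swap : ∀ s (l : List (Fin n)) → letters (swap s l) ≡ letters l
  letters-swap zero    []          = refl
  letters-swap zero    (x ∷ [])    = refl
  letters-swap zero    (x ∷ y ∷ l) = trans (sym (SP.∪-assoc ⁅ y ⁆ ⁅ x ⁆ _))
    (trans (cong (_∪ letters l) (SP.∪-comm ⁅ y ⁆ ⁅ x ⁆)) (SP.∪-assoc ⁅ x ⁆ ⁅ y ⁆ _))
  letters-swap (suc s) []          = refl
  letters-swap (suc s) (x ∷ l)     = cong (⁅ x ⁆ ∪_) (letters-swap s l)

  -- Merging two consecutive blocks of σ(w, c) gives the letters of the union of the two ranges.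
  letters-take-+ : ∀ a b (l : List (Fin n)) →
    letters (take a l) ∪ letters (take b (drop a l)) ≡ letters (take (a + b) l)
  letters-take-+ zero    b l       = SP.∪-identityˡ _
  letters-take-+ (suc a) b []      rewrite LP.take-[] {A = Fin n} b = SP.∪-identityˡ _
  letters-take-+ (suc a) b (x ∷ l) = trans (SP.∪-assoc ⁅ x ⁆ _ _) (cong (⁅ x ⁆ ∪_) (letters-take-+ a b l))

-- cutAt i c = c₁ + ⋯ + c_{i+1}, the (i+1)-th cut of c.
cutAt : ℕ → List ℕ → ℕ
cutAt i       []      = 0
cutAt zero    (x ∷ c) = x
cutAt (suc i) (x ∷ c) = x + cutAt i c

cutAt-positive : ∀ i x c → All (_> 0) (x ∷ c) → 0 < cutAt i (x ∷ c)
cutAt-positive zero    x c (x>0 ∷ _) = x>0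
cutAt-positive (suc i) x c (x>0 ∷ _) = ℕP.<-≤-trans x>0 (ℕP.m≤m+n x _)

-- Exchanging the two letters around the (i+1)-th cut does not change the
-- i-th merge of σ(w, c): they end up in the same (merged) block, and all
-- other blocks are unaffected.
merge-swap : ∀ {n} i a b rest s (l : List (Fin n)) → All (_> 0) (a ∷ b ∷ rest) → i < suc (length rest) →
  suc s ≡ cutAt i (a ∷ b ∷ rest) →
  merge i (σ (swap s l) (a ∷ b ∷ rest)) ≡ merge i (σ l (a ∷ b ∷ rest))
merge-swap zero a b rest s l (_ ∷ b>0 ∷ _) _ 1+s≡a = cong₂ (λ X Y → X ∷ σ Y rest) merged rest-unchanged
  where
  bound : suc (suc s) ≤ a + b
  bound = subst (λ z → suc z ≤ a + b) (sym 1+s≡a) (subst (_≤ a + b) (ℕP.+-comm a 1) (ℕP.+-monoʳ-≤ a b>0))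
  merged : letters (take a (swap s l)) ∪ letters (take b (drop a (swap s l)))
         ≡ letters (take a l) ∪ letters (take b (drop a l))
  merged = trans (letters-take-+ a b (swap s l)) (trans (cong letters (take-swap s (a + b) l bound))
             (trans (letters-swap s _) (sym (letters-take-+ a b l))))
  rest-unchanged : drop b (drop a (swap s l)) ≡ drop b (drop a l)
  rest-unchanged = trans (LP.drop-drop a b _) (trans (drop-swap s (a + b) l bound) (sym (LP.drop-drop a b l)))
merge-swap (suc i) a b []         s l _           (s≤s ())  _
merge-swap (suc i) a b (r ∷ rest) s l (_ ∷ pos) (s≤s i<) 1+s≡ = begin
  merge (suc i) (σ (swap s l) c)
    ≡⟨ nthFace-map (X (swap s l) ∷_) i _ (in-range (swap s l)) ⟩
  X (swap s l) ∷ merge i (σ (drop a (swap s l)) (b ∷ r ∷ rest))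
    ≡⟨ cong₂ (λ U V → letters U ∷ merge i (σ V (b ∷ r ∷ rest)))
         (subst (λ z → take a (swap z l) ≡ take a l) (sym s≡a+s′) (take-swap-beyond a s′ l))
         (subst (λ z → drop a (swap z l) ≡ swap s′ (drop a l)) (sym s≡a+s′) (drop-swap-beyond a s′ l)) ⟩
  X l ∷ merge i (σ (swap s′ (drop a l)) (b ∷ r ∷ rest))
    ≡⟨ cong (X l ∷_) (merge-swap i b r rest s′ (drop a l) pos i< 1+s′≡) ⟩
  X l ∷ merge i (σ (drop a l) (b ∷ r ∷ rest))
    ≡⟨ nthFace-map (X l ∷_) i _ (in-range l) ⟨
  merge (suc i) (σ l c) ∎
  where
  open ≡-Reasoning
  c = a ∷ b ∷ r ∷ rest
  X : List _ → Subset _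
  X w = letters (take a w)
  s′ = ℕ.pred (cutAt i (b ∷ r ∷ rest))
  1+s′≡ : suc s′ ≡ cutAt i (b ∷ r ∷ rest)
  1+s′≡ = ℕP.suc-pred _ {{ℕ.>-nonZero (cutAt-positive i b (r ∷ rest) pos)}}
  s≡a+s′ : s ≡ a + s′
  s≡a+s′ = ℕP.suc-injective (trans 1+s≡ (trans (cong (λ z → a + z) (sym 1+s′≡)) (ℕP.+-suc a s′)))
  in-range : ∀ w → i < length (merges (σ (drop a w) (b ∷ r ∷ rest)))
  in-range w = subst (i <_) (sym (trans (length-merges (σ (drop a w) (b ∷ r ∷ rest)))
    (cong ℕ.pred (length-σ (drop a w) (b ∷ r ∷ rest))))) i<

≡ᵇ-+ˡ : ∀ a p z → (a + p ≡ᵇ a + z) ≡ (p ≡ᵇ z)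
≡ᵇ-+ˡ zero    p z = refl
≡ᵇ-+ˡ (suc a) p z = ≡ᵇ-+ˡ a p z

cutAt-isCut : ∀ i a b rest → i < suc (length rest) → isCut (a ∷ b ∷ rest) (cutAt i (a ∷ b ∷ rest)) ≡ true
cutAt-isCut zero    a b rest       _        rewrite ≡ᵇ-refl a = refl
cutAt-isCut (suc i) a b []         (s≤s ())
cutAt-isCut (suc i) a b (r ∷ rest) (s≤s i<) =
  trans (cong (((a + p) ≡ᵇ a) ∨_) shifted) (BP.∨-zeroʳ _)
  where
  p = cutAt i (b ∷ r ∷ rest)
  shifted : any ((a + p) ≡ᵇ_) (map (λ z → a + z) (cuts (b ∷ r ∷ rest))) ≡ true
  shifted = trans (cong (foldr _∨_ false) (trans (sym (LP.map-∘ (cuts (b ∷ r ∷ rest))))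
              (LP.map-cong (≡ᵇ-+ˡ a p) (cuts (b ∷ r ∷ rest))))) (cutAt-isCut i b r rest i<)

cutAt-<-sum : ∀ i a b rest → All (_> 0) (a ∷ b ∷ rest) → i < suc (length rest) →
  cutAt i (a ∷ b ∷ rest) < sum (a ∷ b ∷ rest)
cutAt-<-sum zero a b rest (_ ∷ b>0 ∷ _) _ =
  subst (_< a + (b + sum rest)) (ℕP.+-identityʳ a) (ℕP.+-monoʳ-< a (ℕP.<-≤-trans b>0 (ℕP.m≤m+n b _)))
cutAt-<-sum (suc i) a b []         _         (s≤s ())
cutAt-<-sum (suc i) a b (r ∷ rest) (_ ∷ pos) (s≤s i<) = ℕP.+-monoʳ-< a (cutAt-<-sum i b r rest pos i<)

guarded-antisymmetric : ∀ (i₁ i₂ c₁ c₂ : Bool) (s₁ s₂ x : ℤ) →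
  i₁ ≡ i₂ → c₁ ≡ c₂ → (i₂ ≡ true → s₁ ≡ - s₂) →
  (if i₁ then (if c₁ then s₁ ℤ.* x else + 0) else + 0)
    ≡ - (if i₂ then (if c₂ then s₂ ℤ.* x else + 0) else + 0)
guarded-antisymmetric false .false c₁ .c₁ s₁ s₂ x refl refl flips = refl
guarded-antisymmetric true  .true  false .false s₁ s₂ x refl refl flips = refl
guarded-antisymmetric true  .true  true  .true  s₁ s₂ x refl refl flips =
  trans (cong (ℤ._* x) (flips refl)) (sym (ℤP.neg-distribˡ-* s₂ x))

-- The heart of the proof: for i < k-1, precomposing with the transposition of the
-- two positions around the (i+1)-th cut preserves 𝔖^c_c and the i-th merge and
-- flips the sign, so the contributions to the i-th merge cancel in pairs.
merge-contributions-cancel : ∀ n c₁ cs → All (_> 0) (c₁ ∷ cs) → sum (c₁ ∷ cs) ≡ n →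
  (α : Permutation′ n) (ρ : Face n) → ∀ i → i < length cs →
  Σ (Expansion.term (c₁ ∷ cs) α ρ i) (allWords n n) ≡ + 0
merge-contributions-cancel n c₁ []         pos total α ρ i ()
merge-contributions-cancel n c₁ (b ∷ rest) pos total α ρ i i< = Σ-antisymmetric n n s (term i) term-swap
  where
  open Expansion (c₁ ∷ b ∷ rest) α ρ
  c = c₁ ∷ b ∷ rest
  s = ℕ.pred (cutAt i c)
  1+s≡cut : suc s ≡ cutAt i c
  1+s≡cut = ℕP.suc-pred _ {{ℕ.>-nonZero (cutAt-positive i c₁ (b ∷ rest) pos)}}
  bound : suc s < n
  bound = subst₂ _<_ (sym 1+s≡cut) total (cutAt-<-sum i c₁ b rest pos i<)
  cut : isCut c (suc s) ≡ true
  cut = subst (λ z → isCut c z ≡ true) (sym 1+s≡cut) (cutAt-isCut i c₁ b rest i<)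
  same-face : ∀ γ → mergedFace i (swapᵛ s γ) ≡ mergedFace i γ
  same-face γ = trans (cong (λ w → merge i (σ w c)) (compose-swap α s γ))
                      (merge-swap i c₁ b rest s (compose α γ) pos i< 1+s≡cut)
  term-swap : ∀ γ → term i (swapᵛ s γ) ≡ - term i γ
  term-swap γ = trans (cong (λ t → if injectiveᵇ (swapᵛ s γ) then (if inColumnGroup c (swapᵛ s γ)
                  then sign (swapᵛ s γ) ℤ.* (sgn i ℤ.* δ ρ t) else + 0) else + 0) (same-face γ))
    (guarded-antisymmetric _ _ _ _ (sign (swapᵛ s γ)) (sign γ) (sgn i ℤ.* δ ρ (mergedFace i γ))
      (injective-swap s γ) (column-swap c s γ cut bound) (SignOfSwap.sign-swap s γ bound))

lemma6p5 : (n : ℕ) (c₁ : ℕ) (cs : List ℕ) →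
    All (_> 0) (c₁ ∷ cs) → sum (c₁ ∷ cs) ≡ n →
    (α : Permutation′ n) →
    IsZero (∂ (g (c₁ ∷ cs) α))
lemma6p5 n c₁ cs pos total α ρ = begin
  coeff ρ (∂ (g (c₁ ∷ cs) α))
    ≡⟨ Expansion.coeff-∂g (c₁ ∷ cs) α ρ ⟩
  Σᵢ (length cs) (λ i → Σ (Expansion.term (c₁ ∷ cs) α ρ i) (allWords n n))
    ≡⟨ Σᵢ-vanishing (length cs) _ (merge-contributions-cancel n c₁ cs pos total α ρ) ⟩
  + 0 ∎
  where open ≡-Reasoning
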